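{- Let $T$ be an irreducible, minimum-cost two-way-comparison decision tree for an instance $(Q,w,\mathcal C,K)$. Let $x$ be any allowed test (not necessarily in $T$), let $j\ge1$, and let $u_1\to\cdots\to u_{j+1}$ be a prefix of the $x$-consistent path from $u_1$, with $u_i'$ the sibling of $u_i$. For $1\le i\le j-1$, let $\delta_i$ be the number of indices $s\in\{1,\dots,i-1\}$ such that the outcomes $u_s\to u_{s+1}'$ and $u_i\to u_{i+1}'$ are consistent with opposite outcomes at $x$. Let $\beta'$ be the number of indices $s\in\{1,\dots,j\}$ such that the outcome $u_s\to u_{s+1}'$ is consistent with the yes-outcome of $x$ (so $0\le\beta'\le j$). Then \[ w(u_2')\;\ge\;\min(j-1-\beta',\,\beta'-1)\,w(u_j)+\sum_{i=3}^{j}(\delta_{i-1}-1)\,w(u_i'). \]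
   Context: An instance $(Q,w,\mathcal C,K)$ consists of a totally ordered finite set $Q$ of queries with weights $w(q)\ge0$, a collection $\mathcal C\subseteq 2^Q$ of classes, and a set $K\subseteq Q$ of keys; every query belongs to some class. An allowed test is "$q<k$" for some $k\in K$ with $\min Q<k\le\max Q$, or "$q=k$" for some $k\in K$. A two-way-comparison decision tree is a rooted binary tree whose non-leaf nodes are allowed tests, with children labeled by the outcomes yes/no, and whose leaves are labeled by classes, each leaf's class containing every query whose search ends there. The search for $q$ starts at the root and moves to the yes-child if $q$ satisfies the test and to the no-child otherwise; $q$ reaches every node on its search path; its depth is the number of tests on the path; the cost of the tree is $\sum_q w(q)\,\mathrm{depth}(q)$. $Q_u$ is the set of queries reaching node $u$, and $w(u)=\sum_{q\in Q_u}w(q)$. The tree is irreducible if for every node $u$, at least one query reaches $u$, and if some class contains all of $Q_u$ then $u$ is a leaf. An edge $u\to v$ to a child is identified with the corresponding outcome at $u$. Two outcomes are consistent if some query in $Q$ satisfies both, otherwise inconsistent. For a node $u$ of $T$, the $x$-consistent path from $u$ is the maximal downward path from $u$ in the subtree rooted at $u$ such that each outcome along it is consistent with both outcomes of the test $x$.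
   Formalization: The query weights $w(q)$ are nonnegative rationals. -}

module Defs where

open import Data.Nat as ℕ using (ℕ; zero; suc; _∸_; _<ᵇ_)
open import Data.Bool as B using (Bool; true; false; not; _∧_; _∨_; if_then_else_; T)
open import Data.Fin using (Fin; toℕ)
import Data.Fin.Properties as FinP
open import Data.Fin.Subset using (Subset; _∈_)
open import Data.List using (List; []; _∷_; _++_; length; take; map; foldr; allFin; applyUpTo)
open import Data.Bool.ListAction using (any)
open import Data.List.Membership.Propositional renaming (_∈_ to _∈ₗ_)
open import Data.Integer as ℤ using (ℤ; +_)
open import Data.Rational as ℚ using (ℚ; 0ℚ; _/_)
open import Data.Product using (_×_; _,_; ∃; ∃-syntax)
open import Data.Maybe using (Maybe; just; nothing)
open import Data.Unit using (⊤)
open import Data.Empty using (⊥)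
open import Relation.Nullary using (¬_)
open import Relation.Nullary.Decidable using (⌊_⌋)

private
  variable
    n : ℕ

-- The totally ordered finite query set Q is
-- Fin n (with the order of Fin); weights are w : Fin n → ℚ with w q ≥ 0;
-- classes are a list C of subsets of Q; keys are a subset K of Q.

CoversQ : List (Subset n) → Set
CoversQ {n} C = (q : Fin n) → ∃[ c ] (c ∈ₗ C × q ∈ c)

data Test (n : ℕ) : Set where
  lt : Fin n → Test n
  eq : Fin n → Test n

test : Test n → Fin n → Bool
test (lt k) q = toℕ q <ᵇ toℕ k
test (eq k) q = ⌊ q FinP.≟ k ⌋

-- allowed tests: "q < k" with k ∈ K and min Q < k ≤ max Q
-- (min Q is index 0; k ≤ max Q holds automatically), or "q = k" with k ∈ K.
Allowed : Subset n → Test n → Set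
Allowed K (lt k) = k ∈ K × (0 ℕ.< toℕ k)
Allowed K (eq k) = k ∈ K

-- an outcome of a test: (test , true) = yes, (test , false) = no
Outcome : ℕ → Set
Outcome n = Test n × Bool

satisfies : Fin n → Outcome n → Bool
satisfies q (t , b) = ⌊ test t q B.≟ b ⌋

consistent : Outcome n → Outcome n → Bool
consistent {n} o o′ = any (λ q → satisfies q o ∧ satisfies q o′) (allFin n)

consistentBoth : Test n → Outcome n → Bool
consistentBoth x o = consistent o (x , true) ∧ consistent o (x , false)

data Tree (n : ℕ) : Set where
  leaf : Subset n → Tree n
  node : Test n → Tree n → Tree n → Tree n       -- test, yes-child, no-child

child : Bool → Tree n → Tree n → Tree n
child true  y _ = y
child false _ m = m

-- validity relative to the set R of queries reaching the current node:
-- tests are allowed, leaf labels are classes, and each leaf's class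
-- contains every query whose search ends there.
ValidAt : Subset n → List (Subset n) → (Fin n → Bool) → Tree n → Set
ValidAt K C R (leaf c) = c ∈ₗ C × (∀ q → T (R q) → q ∈ c)
ValidAt K C R (node t y m) =
  Allowed K t × ValidAt K C (λ q → R q ∧ test t q) y
              × ValidAt K C (λ q → R q ∧ not (test t q)) m

IsDecisionTree : Subset n → List (Subset n) → Tree n → Set
IsDecisionTree K C t = ValidAt K C (λ _ → true) t

depth : Tree n → Fin n → ℕ
depth (leaf _) q = 0
depth (node t y m) q = suc (if test t q then depth y q else depth m q)

ℕtoℚ : ℕ → ℚ
ℕtoℚ k = + k / 1

ℤtoℚ : ℤ → ℚ
ℤtoℚ z = z / 1

sumQ : (Fin n → ℚ) → ℚ
sumQ {n} f = foldr (λ q acc → f q ℚ.+ acc) 0ℚ (allFin n)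

cost : (Fin n → ℚ) → Tree n → ℚ
cost w t = sumQ (λ q → w q ℚ.* ℕtoℚ (depth t q))

MinCost : (Fin n → ℚ) → Subset n → List (Subset n) → Tree n → Set
MinCost {n} w K C t = (t′ : Tree n) → IsDecisionTree K C t′ → cost w t ℚ.≤ cost w t′

-- irreducibility, relative to the set R of queries reaching the node:
-- at least one query reaches every node, and if some class contains
-- all queries reaching a node, that node is a leaf.
IrredAt : List (Subset n) → (Fin n → Bool) → Tree n → Set
IrredAt C R (leaf _) = ∃[ q ] T (R q)
IrredAt {n} C R (node t y m) =
  (∃[ q ] T (R q))
  × ¬ (∃[ c ] (c ∈ₗ C × ((q : Fin n) → T (R q) → q ∈ c)))
  × IrredAt C (λ q → R q ∧ test t q) y
  × IrredAt C (λ q → R q ∧ not (test t q)) m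

Irreducible : List (Subset n) → Tree n → Set
Irreducible C t = IrredAt C (λ _ → true) t

-- Nodes are positions: lists of outcomes (true = yes) from the root.

Pos : Set
Pos = List Bool

subtree : Tree n → Pos → Maybe (Tree n)
subtree t [] = just t
subtree (leaf _) (_ ∷ _) = nothing
subtree (node _ y m) (true ∷ p) = subtree y p
subtree (node _ y m) (false ∷ p) = subtree m p

testAt : Tree n → Pos → Maybe (Test n)
testAt t p with subtree t p
... | just (node x _ _) = just x
... | _ = nothing

reaches : Tree n → Fin n → Pos → Bool
reaches t q [] = true
reaches (leaf _) q (_ ∷ _) = false
reaches (node x y m) q (true ∷ p) = test x q ∧ reaches y q p
reaches (node x y m) q (false ∷ p) = not (test x q) ∧ reaches m q p

weightAt : (Fin n → ℚ) → Tree n → Pos → ℚ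
weightAt w t p = sumQ (λ q → if reaches t q p then w q else 0ℚ)

-- The downward path from the root of a subtree following directions ds
-- is the (maximal) x-consistent path: every outcome along it is
-- consistent with both outcomes of x, and it cannot be extended.
IsXConsistentPath : Test n → Tree n → List Bool → Set
IsXConsistentPath x (leaf _) [] = ⊤
IsXConsistentPath x (leaf _) (_ ∷ _) = ⊥
IsXConsistentPath x (node t y m) [] =
  ¬ T (consistentBoth x (t , true)) × ¬ T (consistentBoth x (t , false))
IsXConsistentPath x (node t y m) (true ∷ ds) =
  T (consistentBoth x (t , true)) × IsXConsistentPath x y ds
IsXConsistentPath x (node t y m) (false ∷ ds) =
  T (consistentBoth x (t , false)) × IsXConsistentPath x m ds

-- Quantities along a path u₁ → ⋯ → u_{j+1}, where u₁ is at position p₁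
-- and ds (of length j) are the outcomes taken.  Indices are 1-based.

-- s-th direction (1-based); default irrelevant for 1 ≤ s ≤ j
dirAt : List Bool → ℕ → Bool
dirAt [] _ = false
dirAt (d ∷ _) 1 = d
dirAt (_ ∷ ds) (suc (suc s)) = dirAt ds (suc s)
dirAt (_ ∷ _) zero = false

pathNode : Pos → List Bool → ℕ → Pos
pathNode p₁ ds i = p₁ ++ take (i ∸ 1) ds

-- u_i′ , the sibling of u_i (for i ≥ 2)
pathSibling : Pos → List Bool → ℕ → Pos
pathSibling p₁ ds i = p₁ ++ take (i ∸ 2) ds ++ (not (dirAt ds (i ∸ 1)) ∷ [])

sibOutcome : Tree n → Pos → List Bool → ℕ → Maybe (Outcome n)
sibOutcome t p₁ ds s with testAt t (pathNode p₁ ds s)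
... | just x = just (x , not (dirAt ds s))
... | nothing = nothing

consistentM : Maybe (Outcome n) → Outcome n → Bool
consistentM (just o) o′ = consistent o o′
consistentM nothing _ = false

oppositeAt : Test n → Maybe (Outcome n) → Maybe (Outcome n) → Bool
oppositeAt x o o′ =
  (consistentM o (x , true) ∧ consistentM o′ (x , false))
  ∨ (consistentM o (x , false) ∧ consistentM o′ (x , true))

range : ℕ → ℕ → List ℕ
range a b = applyUpTo (λ k → a ℕ.+ k) (suc b ∸ a)

count : (ℕ → Bool) → List ℕ → ℕ
count p = foldr (λ s acc → if p s then suc acc else acc) 0

δ : Tree n → Test n → Pos → List Bool → ℕ → ℕ
δ t x p₁ ds i =
  count (λ s → oppositeAt x (sibOutcome t p₁ ds s) (sibOutcome t p₁ ds i)) (range 1 (i ∸ 1))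

β′ : Tree n → Test n → Pos → List Bool → ℕ
β′ t x p₁ ds = count (λ s → consistentM (sibOutcome t p₁ ds s) (x , true)) (range 1 (length ds))

sumRangeQ : (ℕ → ℚ) → List ℕ → ℚ
sumRangeQ f = foldr (λ i acc → f i ℚ.+ acc) 0ℚ

-- Let T′ be T with the subtree at u₁ replaced by a node testing x
-- whose yes- and no-child are copies of that subtree in which each path node u_s
-- (s ≤ j) whose off-path outcome u_s → u′_{s+1} is inconsistent with the respective
-- outcome of x is contracted into its on-path child.  T′ is again a decision tree, so
-- cost T ≤ cost T′.  A query reaching u₁ becomes one test deeper because of x and one
-- test shallower for every contracted node it passes before leaving the path.  Two
-- comparison tests never realise all four combinations of outcomes, and the on-path
-- outcomes are consistent with both outcomes of x, so every off-path outcome is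
-- consistent with at most one of them.  This bounds the savings from below: by
-- min(j−1−β′, β′−1) + 1 for a query reaching u_j and by δ_k for one reaching u′_{k+1}
-- (2 ≤ k < j), while queries reaching u′₂ save nothing.  Weighting these per-query
-- bounds by w and comparing the costs of T and T′ gives the inequality.

module Submission where

open import Defs
open import Data.Nat using (ℕ; _≤_)
open import Data.Fin using (Fin)
open import Data.Fin.Subset using (Subset)
open import Data.List using (List; length; _++_)
open import Data.Bool using (Bool)
open import Data.Maybe using (just)
open import Data.Integer using (+_; _-_; _⊓_)
open import Data.Rational using (ℚ; 0ℚ; _+_; _*_; _≥_)
open import Data.Product using (∃-syntax)
open import Relation.Binary.PropositionalEquality using (_≡_)

open import Data.Nat as ℕ using (zero; suc; _∸_; _<_; _<ᵇ_; _≡ᵇ_; s≤s; z≤n)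
import Data.Nat.Properties as ℕ
open import Data.Integer as ℤ using (ℤ)
import Data.Integer.Properties as ℤ
open import Data.Integer.Tactic.RingSolver using (solve-∀)
import Data.Rational as ℚ
import Data.Rational.Properties as ℚ
import Data.Rational.Unnormalised as ℚᵘ
import Data.Rational.Unnormalised.Properties as ℚᵘ
import Data.Rational.Solver as ℚ-Solver
open import Data.Bool as Bool using (true; false; not; _∧_; _∨_; if_then_else_; T)
open import Data.Bool.Properties using (T-∧; T-≡; T-not-≡; ∨-comm; ∧-assoc)
open import Data.Fin using (toℕ)
import Data.Fin.Properties as Fin
open import Data.Maybe as Maybe using (Maybe; nothing)
open import Data.List using ([]; _∷_; _∷ʳ_; map; foldr; take; allFin)
open import Data.List.Properties using (applyUpTo-∷ʳ; map-applyUpTo; length-applyUpTo)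
open import Data.List.Relation.Unary.Any using (here; there; satisfied)
open import Data.List.Relation.Unary.Any.Properties using (any⁺; any⁻)
import Data.List.Relation.Unary.All as All
open import Data.List.Relation.Unary.AllPairs using (_∷_)
open import Data.List.Relation.Unary.Unique.Propositional using (Unique)
open import Data.List.Relation.Unary.Unique.Propositional.Properties using (applyUpTo⁺₁)
open import Data.List.Membership.Propositional using (_∈_; lose)
open import Data.List.Membership.Propositional.Properties using (∈-allFin; ∈-applyUpTo⁺; ∈-applyUpTo⁻)
open import Data.Product using (_×_; _,_; proj₁; proj₂; swap; map₂)
open import Data.Sum using (_⊎_; inj₁; inj₂; [_,_])
open import Data.Empty using (⊥-elim)
open import Function using (_∘_; _⇔_; mk⇔; Equivalence)
open import Relation.Nullary using (¬_; contradiction)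
open import Relation.Nullary.Decidable using (toWitness; fromWitness)
open import Relation.Binary.PropositionalEquality
  using (_≢_; refl; sym; trans; cong; cong₂; subst; subst₂; ≢-sym; module ≡-Reasoning)

private variable n : ℕ

eq-yes : (k q : Fin n) → test (eq k) q ≡ true → q ≡ k
eq-yes k q h = toWitness {a? = q Fin.≟ k} (Equivalence.from T-≡ h)

lt-yes : (k q : Fin n) → test (lt k) q ≡ true → toℕ q < toℕ k
lt-yes k q h = ℕ.<ᵇ⇒< (toℕ q) (toℕ k) (Equivalence.from T-≡ h)

lt-no : (k q : Fin n) → test (lt k) q ≡ false → toℕ k ≤ toℕ q
lt-no k q h = ℕ.≮⇒≥ (λ q<k → subst T h (ℕ.<⇒<ᵇ q<k))

T-∧⁺ : {a b : Bool} → T a → T b → T (a ∧ b)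
T-∧⁺ p q = Equivalence.from T-∧ (p , q)

T-∧⁻ : {a b : Bool} → T (a ∧ b) → T a × T b
T-∧⁻ = Equivalence.to T-∧

satisfies⇔ : (q : Fin n) (t : Test n) {b : Bool} → T (satisfies q (t , b)) ⇔ test t q ≡ b
satisfies⇔ q t {b} = mk⇔ (toWitness {a? = test t q Bool.≟ b}) fromWitness

consistent⁺ : (t t′ : Test n) {b b′ : Bool} (q : Fin n) → test t q ≡ b → test t′ q ≡ b′
            → T (consistent (t , b) (t′ , b′))
consistent⁺ t t′ q e e′ =
  any⁺ _ (lose (∈-allFin q) (T-∧⁺ (Equivalence.from (satisfies⇔ q t) e) (Equivalence.from (satisfies⇔ q t′) e′)))

consistent⁻ : (t t′ : Test n) {b b′ : Bool} → T (consistent (t , b) (t′ , b′))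
            → ∃[ q ] (test t q ≡ b × test t′ q ≡ b′)
consistent⁻ t t′ h with q , sat ← satisfied (any⁻ _ (allFin _) h) =
  q , Equivalence.to (satisfies⇔ q t) (proj₁ (T-∧⁻ sat)) , Equivalence.to (satisfies⇔ q t′) (proj₂ (T-∧⁻ sat))

Region : Test n → Test n → Bool → Bool → Set
Region {n} t x c e = ∃[ q ] (test t q ≡ c × test x q ≡ e)

-- An equality test has a single yes-query and two threshold tests are nested.
¬allRegions : (t x : Test n) → ¬ (∀ c e → Region t x c e)
¬allRegions (eq a) x r
  with q , t-yes , x-yes ← r true true | q′ , t-yes′ , x-no ← r true false
  with refl ← eq-yes a q t-yes | refl ← eq-yes a q′ t-yes′
  = contradiction (trans (sym x-yes) x-no) λ ()
¬allRegions (lt a) (eq c) r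
  with q , t-yes , x-yes ← r true true | q′ , t-no , x-yes′ ← r false true
  with refl ← eq-yes c q x-yes | refl ← eq-yes c q′ x-yes′
  = contradiction (trans (sym t-yes) t-no) λ ()
¬allRegions (lt a) (lt c) r
  with q , t-yes , x-no ← r true false | q′ , t-no , x-yes ← r false true
  = ℕ.<-asym (ℕ.≤-<-trans (lt-no c q x-no) (lt-yes a q t-yes))
             (ℕ.≤-<-trans (lt-no a q′ t-no) (lt-yes c q′ x-yes))

consistentBoth⇒Region : (x t : Test n) {c : Bool} → T (consistentBoth x (t , c)) → ∀ e → Region t x c e
consistentBoth⇒Region x t h true  = consistent⁻ t x (proj₁ (T-∧⁻ h))
consistentBoth⇒Region x t h false = consistent⁻ t x (proj₂ (T-∧⁻ h))

consistentBoth-exclusive : (x t : Test n) (d : Bool)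
                         → T (consistentBoth x (t , d)) → ¬ T (consistentBoth x (t , not d))
consistentBoth-exclusive x t true h h′ =
  ¬allRegions t x λ { true → consistentBoth⇒Region x t h ; false → consistentBoth⇒Region x t h′ }
consistentBoth-exclusive x t false h h′ =
  ¬allRegions t x λ { true → consistentBoth⇒Region x t h′ ; false → consistentBoth⇒Region x t h }

count-cong : {p p′ : ℕ → Bool} (xs : List ℕ) → (∀ {s} → s ∈ xs → p s ≡ p′ s) → count p xs ≡ count p′ xs
count-cong []       _ = refl
count-cong {p} (x ∷ xs) h rewrite h (here refl) | count-cong {p} xs (h ∘ there) = refl

count-mono : {p p′ : ℕ → Bool} (xs : List ℕ) → (∀ {s} → s ∈ xs → T (p s) → T (p′ s))
           → count p xs ≤ count p′ xs
count-mono [] _ = z≤n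
count-mono {p} {p′} (x ∷ xs) h with p x in px | p′ x in p′x
... | true  | true  = s≤s (count-mono xs (h ∘ there))
... | true  | false = ⊥-elim (subst T p′x (h (here refl) (subst T (sym px) _)))
... | false | true  = ℕ.m≤n⇒m≤1+n (count-mono xs (h ∘ there))
... | false | false = count-mono xs (h ∘ there)

count+count-not : (p : ℕ → Bool) (xs : List ℕ) → count p xs ℕ.+ count (not ∘ p) xs ≡ length xs
count+count-not p []       = refl
count+count-not p (x ∷ xs) with p x
... | true  = cong suc (count+count-not p xs)
... | false = trans (ℕ.+-suc _ _) (cong suc (count+count-not p xs))

count-++ : (p : ℕ → Bool) (xs ys : List ℕ) → count p (xs ++ ys) ≡ count p xs ℕ.+ count p ys
count-++ p []       ys = refl
count-++ p (x ∷ xs) ys with p x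
... | true  = cong suc (count-++ p xs ys)
... | false = count-++ p xs ys

count-∷ : (p : ℕ → Bool) (x : ℕ) (xs : List ℕ) → count p (x ∷ xs) ≡ (if p x then 1 else 0) ℕ.+ count p xs
count-∷ p x xs with p x
... | true  = refl
... | false = refl

count-map : (p : ℕ → Bool) (f : ℕ → ℕ) (xs : List ℕ) → count p (map f xs) ≡ count (p ∘ f) xs
count-map p f []       = refl
count-map p f (x ∷ xs) with p (f x)
... | true  = cong suc (count-map p f xs)
... | false = count-map p f xs

∈-range⁺ : {a b s : ℕ} → a ≤ s → s ≤ b → s ∈ range a b
∈-range⁺ {a} {b} a≤s s≤b =
  subst (_∈ range a b) (ℕ.m+[n∸m]≡n a≤s) (∈-applyUpTo⁺ (a ℕ.+_) (ℕ.∸-monoˡ-< (s≤s s≤b) a≤s))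

∈-range⁻ : (a b : ℕ) {s : ℕ} → s ∈ range a b → a ≤ s × s ≤ b
∈-range⁻ a b s∈ with i , i<m , refl ← ∈-applyUpTo⁻ (a ℕ.+_) s∈ =
  ℕ.m≤m+n a i , ℕ.≤-pred (subst (_≤ suc b) (trans (ℕ.+-comm (suc i) a) (ℕ.+-suc a i))
                                             (ℕ.m≤o∸n⇒m+n≤o (suc i) a≤1+b i<m))
  where
  a≤1+b : a ≤ suc b
  a≤1+b = ℕ.<⇒≤ (ℕ.m∸n≢0⇒n<m (ℕ.m<n⇒n≢0 i<m))

range-unique : (a b : ℕ) → Unique (range a b)
range-unique a b = applyUpTo⁺₁ (a ℕ.+_) (suc b ∸ a) (λ i<k _ eq → ℕ.<⇒≢ i<k (ℕ.+-cancelˡ-≡ a _ _ eq))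

range1-suc : (m : ℕ) → range 1 (suc m) ≡ 1 ∷ map suc (range 1 m)
range1-suc m = cong (1 ∷_) (sym (map-applyUpTo (1 ℕ.+_) suc m))

range1-∷ʳ : (m : ℕ) → range 1 (suc m) ≡ range 1 m ∷ʳ suc m
range1-∷ʳ m = sym (applyUpTo-∷ʳ (1 ℕ.+_) m)

length-range1 : (m : ℕ) → length (range 1 m) ≡ m
length-range1 = length-applyUpTo (1 ℕ.+_)

count-range1-suc : (p : ℕ → Bool) (K : ℕ)
                 → count p (range 1 (suc K)) ≡ (if p 1 then 1 else 0) ℕ.+ count (p ∘ suc) (range 1 K)
count-range1-suc p K =
  trans (cong (count p) (range1-suc K))
        (trans (count-∷ p 1 (map suc (range 1 K))) (cong (_ ℕ.+_) (count-map p suc (range 1 K))))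

sumℤ : (ℕ → ℤ) → List ℕ → ℤ
sumℤ f = foldr (λ i acc → f i ℤ.+ acc) (+ 0)

sumℤ-cong : {f g : ℕ → ℤ} (xs : List ℕ) → (∀ {i} → i ∈ xs → f i ≡ g i) → sumℤ f xs ≡ sumℤ g xs
sumℤ-cong []       _ = refl
sumℤ-cong (x ∷ xs) h = cong₂ ℤ._+_ (h (here refl)) (sumℤ-cong xs (h ∘ there))

sumℤ-zero : {f : ℕ → ℤ} (xs : List ℕ) → (∀ {i} → i ∈ xs → f i ≡ + 0) → sumℤ f xs ≡ + 0
sumℤ-zero []       _ = refl
sumℤ-zero (x ∷ xs) h = cong₂ ℤ._+_ (h (here refl)) (sumℤ-zero xs (h ∘ there))

sumℤ-single : {f : ℕ → ℤ} {e : ℕ} {xs : List ℕ} → Unique xs → e ∈ xs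
            → (∀ {i} → i ∈ xs → i ≢ e → f i ≡ + 0) → sumℤ f xs ≡ f e
sumℤ-single {f} (x∉ ∷ _) (here refl) h =
  trans (cong (ℤ._+_ (f _)) (sumℤ-zero _ λ i∈ → h (there i∈) (≢-sym (All.lookup x∉ i∈)))) (ℤ.+-identityʳ _)
sumℤ-single (x∉ ∷ u) (there e∈) h =
  trans (cong₂ ℤ._+_ (h (here refl) (All.lookup x∉ e∈)) (sumℤ-single u e∈ (h ∘ there))) (ℤ.+-identityˡ _)

¬T⇒≡false : {b : Bool} → ¬ T b → b ≡ false
¬T⇒≡false {false} _ = refl
¬T⇒≡false {true}  h = contradiction _ h

≢⇒≡ᵇ-false : {m n : ℕ} → m ≢ n → (m ≡ᵇ n) ≡ false
≢⇒≡ᵇ-false {m} {n} m≢n = ¬T⇒≡false (m≢n ∘ ℕ.≡ᵇ⇒≡ m n)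

≤⇒<ᵇ-false : {m n : ℕ} → n ≤ m → (m <ᵇ n) ≡ false
≤⇒<ᵇ-false {m} {n} n≤m = ¬T⇒≡false (ℕ.≤⇒≯ n≤m ∘ ℕ.<ᵇ⇒< m n)

𝟙 : Bool → ℤ
𝟙 true  = + 1
𝟙 false = + 0

𝟙-nonNegative : (b : Bool) → ℤ.NonNegative (𝟙 b)
𝟙-nonNegative true  = _
𝟙-nonNegative false = _

-- Accounting along an x-consistent path

private
  opposite⇒¬consistent : (ps ns pk nk : Bool) → T pk → ¬ (T pk × T nk) → ¬ (T ps × T ns)
                       → T ((ps ∧ nk) ∨ (ns ∧ pk)) → T (not ps)
  opposite⇒¬consistent false _     _     _     _  _   _   _  = _
  opposite⇒¬consistent true  true  _     _     _  _   exs _  = contradiction _ exs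
  opposite⇒¬consistent true  false true  true  _  exk _   _  = contradiction _ exk
  opposite⇒¬consistent true  false true  false _  _   _   ()
  opposite⇒¬consistent true  false false _     () _   _   _

  ¬both⇒not : {a b : Bool} → ¬ (T a × T b) → T a → T (not b)
  ¬both⇒not {b = false} _ _ = _
  ¬both⇒not {b = true}  h a = h (a , _)

-- The path nodes passed before leaving the path at u_k, or all j of them for k = 0.
nodesBeforeExit : ℕ → ℕ → ℕ
nodesBeforeExit j zero    = j
nodesBeforeExit j (suc k) = k

-- c b s: the off-path outcome u_s → u′_{s+1} is consistent with outcome b of x.
-- Instantiated in the exchange argument, β, opposites, endCoefficient and
-- siblingCoefficient are definitionally β′, δ and the coefficients of the theorem.
module PathCounting (c : Bool → ℕ → Bool) (j : ℕ) where

  Exclusive : Set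
  Exclusive = ∀ {s} → s ∈ range 1 j → ¬ (T (c true s) × T (c false s))

  β : ℕ
  β = count (c true) (range 1 j)

  contracted : Bool → ℕ → ℕ
  contracted b K = count (not ∘ c b) (range 1 K)

  opposites : ℕ → ℕ
  opposites i = count (λ s → (c true s ∧ c false i) ∨ (c false s ∧ c true i)) (range 1 (i ∸ 1))

  endCoefficient : ℤ
  endCoefficient = (+ j - + 1 - + β) ⊓ (+ β - + 1)

  siblingCoefficient : ℕ → ℤ
  siblingCoefficient i = + opposites (i ∸ 1) - + 1

  endCoefficient<contracted : Exclusive → (b : Bool) → endCoefficient ℤ.+ + 1 ℤ.≤ + contracted b j
  endCoefficient<contracted _ true = begin
    endCoefficient ℤ.+ + 1                              ≤⟨ ℤ.+-monoˡ-≤ (+ 1) (ℤ.i⊓j≤i (+ j - + 1 - + β) (+ β - + 1)) ⟩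
    (+ j - + 1 - + β) ℤ.+ + 1                           ≡⟨ cong (λ m → (m - + 1 - + β) ℤ.+ + 1) j≡β+r ⟩
    ((+ β ℤ.+ + contracted true j) - + 1 - + β) ℤ.+ + 1 ≡⟨ cancel (+ β) (+ contracted true j) ⟩
    + contracted true j                                 ∎
    where
    open ℤ.≤-Reasoning
    j≡β+r : + j ≡ + β ℤ.+ + contracted true j
    j≡β+r = trans (cong +_ (sym (trans (count+count-not (c true) (range 1 j)) (length-range1 j)))) (ℤ.pos-+ β _)
    cancel : ∀ a r → ((a ℤ.+ r) - + 1 - a) ℤ.+ + 1 ≡ r
    cancel = solve-∀
  endCoefficient<contracted excl false = begin
    endCoefficient ℤ.+ + 1    ≤⟨ ℤ.+-monoˡ-≤ (+ 1) (ℤ.i⊓j≤j (+ j - + 1 - + β) (+ β - + 1)) ⟩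
    (+ β - + 1) ℤ.+ + 1       ≡⟨ cancel (+ β) ⟩
    + β                       ≤⟨ ℤ.+≤+ (count-mono (range 1 j) (¬both⇒not ∘ excl)) ⟩
    + contracted false j      ∎
    where
    open ℤ.≤-Reasoning
    cancel : ∀ a → (a - + 1) ℤ.+ + 1 ≡ a
    cancel = solve-∀

  contracted-last : (b : Bool) (K : ℕ) → T (c b (suc K)) → contracted b (suc K) ≡ contracted b K
  contracted-last b K cbK = begin
    count (not ∘ c b) (range 1 (suc K))
      ≡⟨ cong (count (not ∘ c b)) (range1-∷ʳ K) ⟩
    count (not ∘ c b) (range 1 K ++ suc K ∷ [])
      ≡⟨ count-++ (not ∘ c b) (range 1 K) _ ⟩
    contracted b K ℕ.+ count (not ∘ c b) (suc K ∷ [])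
      ≡⟨ cong (λ v → contracted b K ℕ.+ (if not v then 1 else 0)) (Equivalence.to T-≡ cbK) ⟩
    contracted b K ℕ.+ 0
      ≡⟨ ℕ.+-identityʳ _ ⟩
    contracted b K ∎
    where open ≡-Reasoning

  opposite⇒inconsistent : (b : Bool) {s k : ℕ} → ¬ (T (c true s) × T (c false s)) → ¬ (T (c true k) × T (c false k))
                        → T (c b k) → T ((c true s ∧ c false k) ∨ (c false s ∧ c true k)) → T (not (c b s))
  opposite⇒inconsistent true  exs exk cbk = opposite⇒¬consistent _ _ _ _ cbk exk exs
  opposite⇒inconsistent false {s} {k} exs exk cbk opp =
    opposite⇒¬consistent _ _ _ _ cbk (exk ∘ swap) (exs ∘ swap) (subst T (∨-comm (c true s ∧ c false k) _) opp)

  opposites≤contracted : Exclusive → (b : Bool) {k : ℕ} → 1 ≤ k → k ≤ j → T (c b k)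
                       → opposites k ≤ contracted b (k ∸ 1)
  opposites≤contracted excl b {k} 1≤k k≤j cbk = count-mono (range 1 (k ∸ 1)) inconsistent
    where
    inconsistent : ∀ {s} → s ∈ range 1 (k ∸ 1) → T ((c true s ∧ c false k) ∨ (c false s ∧ c true k)) → T (not (c b s))
    inconsistent s∈ with 1≤s , s≤k-1 ← ∈-range⁻ 1 (k ∸ 1) s∈ =
      opposite⇒inconsistent b (excl (∈-range⁺ 1≤s (ℕ.≤-trans s≤k-1 (ℕ.≤-trans (ℕ.m∸n≤m k 1) k≤j))))
                              (excl (∈-range⁺ 1≤k k≤j)) cbk

  reachesEnd : ℕ → Bool
  reachesEnd k = (k ≡ᵇ 0) ∨ ((j ∸ 1) <ᵇ k)

  siblingSum : ℕ → ℤ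
  siblingSum k = sumℤ (λ i → siblingCoefficient i ℤ.* 𝟙 (k ≡ᵇ i ∸ 1)) (range 3 j)

  exitContribution : ℕ → ℤ
  exitContribution k = endCoefficient ℤ.* 𝟙 (reachesEnd k) ℤ.+ siblingSum k

  siblingSum-off : {k : ℕ} → k ≤ 1 ⊎ j ≤ k → siblingSum k ≡ + 0
  siblingSum-off {k} out = sumℤ-zero (range 3 j) λ {i} i∈ →
    trans (cong (λ v → siblingCoefficient i ℤ.* 𝟙 v) (≢⇒≡ᵇ-false (k≢ i∈))) (ℤ.*-zeroʳ (siblingCoefficient i))
    where
    k≢ : ∀ {i} → i ∈ range 3 j → k ≢ i ∸ 1
    k≢ {zero}  i∈ _ with () ← proj₁ (∈-range⁻ 3 j i∈)
    k≢ {suc i} i∈ refl with s≤s 2≤i , i<j ← ∈-range⁻ 3 j i∈ =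
      [ (λ i≤1 → ℕ.<-irrefl refl (ℕ.≤-trans 2≤i i≤1)) , (λ j≤i → ℕ.<-irrefl refl (ℕ.≤-trans i<j j≤i)) ] out

  siblingSum-on : {k : ℕ} → 2 ≤ k → k < j → siblingSum k ≡ siblingCoefficient (suc k)
  siblingSum-on {k} 2≤k k<j = begin
    siblingSum k
      ≡⟨ sumℤ-single (range-unique 3 j) (∈-range⁺ (s≤s 2≤k) k<j) off ⟩
    siblingCoefficient (suc k) ℤ.* 𝟙 (k ≡ᵇ k)
      ≡⟨ cong (λ v → siblingCoefficient (suc k) ℤ.* 𝟙 v) (Equivalence.to T-≡ (ℕ.≡⇒≡ᵇ k k refl)) ⟩
    siblingCoefficient (suc k) ℤ.* + 1
      ≡⟨ ℤ.*-identityʳ (siblingCoefficient (suc k)) ⟩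
    siblingCoefficient (suc k) ∎
    where
    open ≡-Reasoning
    off : ∀ {i} → i ∈ range 3 j → i ≢ suc k → siblingCoefficient i ℤ.* 𝟙 (k ≡ᵇ i ∸ 1) ≡ + 0
    off {zero}  i∈ _ with () ← proj₁ (∈-range⁻ 3 j i∈)
    off {suc i} _ i≢ = trans (cong (λ v → siblingCoefficient (suc i) ℤ.* 𝟙 v) (≢⇒≡ᵇ-false (i≢ ∘ cong suc ∘ sym)))
                             (ℤ.*-zeroʳ (siblingCoefficient (suc i)))

  exitContribution-atEnd : {k : ℕ} → reachesEnd k ≡ true → k ≤ 1 ⊎ j ≤ k → exitContribution k ≡ endCoefficient
  exitContribution-atEnd {k} end out = begin
    endCoefficient ℤ.* 𝟙 (reachesEnd k) ℤ.+ siblingSum k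
      ≡⟨ cong₂ (λ u v → endCoefficient ℤ.* 𝟙 u ℤ.+ v) end (siblingSum-off out) ⟩
    endCoefficient ℤ.* + 1 ℤ.+ + 0
      ≡⟨ simplify endCoefficient ⟩
    endCoefficient ∎
    where
    open ≡-Reasoning
    simplify : ∀ a → a ℤ.* + 1 ℤ.+ + 0 ≡ a
    simplify = solve-∀

  exitContribution-inside : {k : ℕ} → 0 < k → k < j → exitContribution k ≡ siblingSum k
  exitContribution-inside {suc k} _ k<j = begin
    endCoefficient ℤ.* 𝟙 (reachesEnd (suc k)) ℤ.+ siblingSum (suc k)
      ≡⟨ cong (λ v → endCoefficient ℤ.* 𝟙 v ℤ.+ siblingSum (suc k)) (≤⇒<ᵇ-false (ℕ.<⇒≤pred k<j)) ⟩
    endCoefficient ℤ.* + 0 ℤ.+ siblingSum (suc k)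
      ≡⟨ simplify endCoefficient (siblingSum (suc k)) ⟩
    siblingSum (suc k) ∎
    where
    open ≡-Reasoning
    simplify : ∀ a s → a ℤ.* + 0 ℤ.+ s ≡ s
    simplify = solve-∀

  exitContribution<contracted : Exclusive → (b : Bool) {k : ℕ} → k ≤ j → (0 < k → T (c b k))
                              → exitContribution k ℤ.+ + 1 ℤ.≤ 𝟙 (k ≡ᵇ 1) ℤ.+ + contracted b (nodesBeforeExit j k)
  exitContribution<contracted excl b {zero} _ _ = begin
    exitContribution 0 ℤ.+ + 1   ≡⟨ cong (ℤ._+ + 1) (exitContribution-atEnd refl (inj₁ z≤n)) ⟩
    endCoefficient ℤ.+ + 1       ≤⟨ endCoefficient<contracted excl b ⟩
    + contracted b j             ≡⟨ ℤ.+-identityˡ _ ⟨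
    + 0 ℤ.+ + contracted b j     ∎
    where open ℤ.≤-Reasoning
  exitContribution<contracted excl b {suc k} k<j cbk with ℕ.m≤n⇒m<n∨m≡n k<j
  ... | inj₂ refl = begin
    exitContribution (suc k) ℤ.+ + 1   ≡⟨ cong (ℤ._+ + 1) (exitContribution-atEnd end (inj₂ ℕ.≤-refl)) ⟩
    endCoefficient ℤ.+ + 1             ≤⟨ endCoefficient<contracted excl b ⟩
    + contracted b (suc k)             ≡⟨ cong +_ (contracted-last b k (cbk (s≤s z≤n))) ⟩
    + contracted b k                   ≤⟨ ℤ.i≤j+i _ (𝟙 (k ≡ᵇ 0)) ⦃ 𝟙-nonNegative (k ≡ᵇ 0) ⦄ ⟩
    𝟙 (k ≡ᵇ 0) ℤ.+ + contracted b k    ∎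
    where
    open ℤ.≤-Reasoning
    end : reachesEnd (suc k) ≡ true
    end = Equivalence.to T-≡ (ℕ.<⇒<ᵇ (ℕ.n<1+n k))
  ... | inj₁ 1+k<j with k
  ...   | zero = ℤ.≤-reflexive (cong (ℤ._+ + 1)
                   (trans (exitContribution-inside (s≤s z≤n) 1+k<j) (siblingSum-off (inj₁ ℕ.≤-refl))))
  ...   | suc k′ = begin
    exitContribution (suc (suc k′)) ℤ.+ + 1
      ≡⟨ cong (ℤ._+ + 1) (trans (exitContribution-inside (s≤s z≤n) 1+k<j) (siblingSum-on (s≤s (s≤s z≤n)) 1+k<j)) ⟩
    siblingCoefficient (suc (suc (suc k′))) ℤ.+ + 1
      ≡⟨ cancel (+ opposites (suc (suc k′))) ⟩
    + opposites (suc (suc k′))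
      ≤⟨ ℤ.+≤+ (opposites≤contracted excl b (s≤s z≤n) (ℕ.<⇒≤ 1+k<j) (cbk (s≤s z≤n))) ⟩
    + contracted b (suc k′)
      ≡⟨ ℤ.+-identityˡ _ ⟨
    + 0 ℤ.+ + contracted b (suc k′) ∎
    where
    open ℤ.≤-Reasoning
    cancel : ∀ a → (a - + 1) ℤ.+ + 1 ≡ a
    cancel = solve-∀

-- Tree surgery

replace : Tree n → Pos → Tree n → Tree n
replace _            []          s = s
replace (leaf c)     (_ ∷ _)     _ = leaf c
replace (node t y m) (true ∷ p)  s = node t (replace y p s) m
replace (node t y m) (false ∷ p) s = node t y (replace m p s)

prunePath : Test n → Bool → Tree n → List Bool → Tree n
prunePath x b S            []          = S
prunePath x b (leaf c)     (_ ∷ _)     = leaf c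
prunePath x b (node t y m) (true ∷ ds) =
  if consistent (t , false) (x , b) then node t (prunePath x b y ds) m else prunePath x b y ds
prunePath x b (node t y m) (false ∷ ds) =
  if consistent (t , true) (x , b) then node t y (prunePath x b m ds) else prunePath x b m ds

subtree-++ : {Tr S : Tree n} (p p′ : Pos) → subtree Tr p ≡ just S → subtree Tr (p ++ p′) ≡ subtree S p′
subtree-++ {Tr = Tr}         []          p′ refl = refl
subtree-++ {Tr = node _ y _} (true ∷ p)  p′ h    = subtree-++ {Tr = y} p p′ h
subtree-++ {Tr = node _ _ m} (false ∷ p) p′ h    = subtree-++ {Tr = m} p p′ h

reaches-++ : {Tr S : Tree n} (q : Fin n) (p p′ : Pos) → subtree Tr p ≡ just S
           → reaches Tr q (p ++ p′) ≡ reaches Tr q p ∧ reaches S q p′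
reaches-++                   q []          p′ refl = refl
reaches-++ {Tr = node t y _} q (true ∷ p)  p′ h    =
  trans (cong (test t q ∧_) (reaches-++ {Tr = y} q p p′ h)) (sym (∧-assoc (test t q) _ _))
reaches-++ {Tr = node t _ m} q (false ∷ p) p′ h    =
  trans (cong (not (test t q) ∧_) (reaches-++ {Tr = m} q p p′ h)) (sym (∧-assoc (not (test t q)) _ _))

depth-replace : {Tr S : Tree n} (S′ : Tree n) (q : Fin n) (p : Pos) → subtree Tr p ≡ just S → reaches Tr q p ≡ true
              → depth (replace Tr p S′) q ℕ.+ depth S q ≡ depth Tr q ℕ.+ depth S′ q
depth-replace {S = S} S′ q [] refl _ = ℕ.+-comm (depth S′ q) (depth S q)
depth-replace {Tr = node t y m} S′ q (true ∷ p) h r with test t q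
... | true = cong suc (depth-replace {Tr = y} S′ q p h r)
depth-replace {Tr = node t y m} S′ q (false ∷ p) h r with test t q
... | false = cong suc (depth-replace {Tr = m} S′ q p h r)

depth-node : (t : Test n) (y m : Tree n) (q : Fin n) → depth (node t y m) q ≡ suc (depth (child (test t q) y m) q)
depth-node t y m q with test t q
... | true  = refl
... | false = refl

depth-replace-unreached : (Tr S′ : Tree n) (q : Fin n) (p : Pos) → reaches Tr q p ≡ false
                        → depth (replace Tr p S′) q ≡ depth Tr q
depth-replace-unreached (leaf _)     S′ q (_ ∷ _)     _ = refl
depth-replace-unreached (node t y m) S′ q (true ∷ p)  r with test t q
... | true  = cong suc (depth-replace-unreached y S′ q p r)
... | false = refl
depth-replace-unreached (node t y m) S′ q (false ∷ p) r with test t q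
... | false = cong suc (depth-replace-unreached m S′ q p r)
... | true  = refl

module _ {K : Subset n} {C : List (Subset n)} where

  valid-mono : {R R′ : Fin n → Bool} (t : Tree n) → (∀ q → T (R′ q) → T (R q))
             → ValidAt K C R t → ValidAt K C R′ t
  valid-mono (leaf c)     R′⊆R (c∈C , cover) = c∈C , λ q r → cover q (R′⊆R q r)
  valid-mono (node t y m) R′⊆R (allowed , vy , vm) =
    allowed , valid-mono y (λ q r → T-∧⁺ (R′⊆R q (proj₁ (T-∧⁻ r))) (proj₂ (T-∧⁻ r))) vy
            , valid-mono m (λ q r → T-∧⁺ (R′⊆R q (proj₁ (T-∧⁻ r))) (proj₂ (T-∧⁻ r))) vm

  valid-subtree : {R : Fin n → Bool} {S : Tree n} (Tr : Tree n) (p : Pos) → subtree Tr p ≡ just S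
                → ValidAt K C R Tr → ValidAt K C (λ q → R q ∧ reaches Tr q p) S
  valid-subtree Tr [] refl v = valid-mono Tr (λ q → proj₁ ∘ T-∧⁻) v
  valid-subtree {R} {S} (node t y m) (true ∷ p) h (_ , vy , _) =
    valid-mono S (λ q → subst T (sym (∧-assoc (R q) (test t q) _))) (valid-subtree y p h vy)
  valid-subtree {R} {S} (node t y m) (false ∷ p) h (_ , _ , vm) =
    valid-mono S (λ q → subst T (sym (∧-assoc (R q) (not (test t q)) _))) (valid-subtree m p h vm)

  valid-replace : {R : Fin n → Bool} (Tr S′ : Tree n) (p : Pos) → ValidAt K C R Tr
                → ValidAt K C (λ q → R q ∧ reaches Tr q p) S′ → ValidAt K C R (replace Tr p S′)
  valid-replace Tr S′ [] _ v′ = valid-mono S′ (λ q r → T-∧⁺ r _) v′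
  valid-replace (leaf c) S′ (_ ∷ _) v _ = v
  valid-replace {R} (node t y m) S′ (true ∷ p) (allowed , vy , vm) v′ =
    allowed , valid-replace y S′ p vy (valid-mono S′ (λ q → subst T (∧-assoc (R q) (test t q) _)) v′) , vm
  valid-replace {R} (node t y m) S′ (false ∷ p) (allowed , vy , vm) v′ =
    allowed , vy , valid-replace m S′ p vm (valid-mono S′ (λ q → subst T (∧-assoc (R q) (not (test t q)) _)) v′)

  valid-prunePath : (x : Test n) (b : Bool) {R R′ : Fin n → Bool} (S : Tree n) (ds : List Bool)
                  → (∀ q → T (R′ q) → T (R q) × test x q ≡ b)
                  → ValidAt K C R S → ValidAt K C R′ (prunePath x b S ds)
  valid-prunePath x b S [] R′⊆R v = valid-mono S (λ q → proj₁ ∘ R′⊆R q) v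
  valid-prunePath x b (leaf c) (_ ∷ _) R′⊆R v = valid-mono (leaf c) (λ q → proj₁ ∘ R′⊆R q) v
  valid-prunePath x b {R} {R′} (node t y m) (true ∷ ds) R′⊆R (allowed , vy , vm)
    with consistent (t , false) (x , b) in ce
  ... | true = allowed , valid-prunePath x b y ds (λ q r → T-∧⁺ (proj₁ (R′⊆R q (proj₁ (T-∧⁻ r)))) (proj₂ (T-∧⁻ r))
                                                           , proj₂ (R′⊆R q (proj₁ (T-∧⁻ r)))) vy
                       , valid-mono m (λ q r → T-∧⁺ (proj₁ (R′⊆R q (proj₁ (T-∧⁻ r)))) (proj₂ (T-∧⁻ r))) vm
  ... | false = valid-prunePath x b y ds (λ q r → T-∧⁺ (proj₁ (R′⊆R q r)) (goesYes q (R′⊆R q r)) , proj₂ (R′⊆R q r)) vy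
    where
    goesYes : ∀ q → T (R q) × test x q ≡ b → T (test t q)
    goesYes q (_ , xb) with test t q in tq
    ... | true  = _
    ... | false = subst T ce (consistent⁺ t x q tq xb)
  valid-prunePath x b {R} {R′} (node t y m) (false ∷ ds) R′⊆R (allowed , vy , vm)
    with consistent (t , true) (x , b) in ce
  ... | true = allowed , valid-mono y (λ q r → T-∧⁺ (proj₁ (R′⊆R q (proj₁ (T-∧⁻ r)))) (proj₂ (T-∧⁻ r))) vy
                       , valid-prunePath x b m ds (λ q r → T-∧⁺ (proj₁ (R′⊆R q (proj₁ (T-∧⁻ r)))) (proj₂ (T-∧⁻ r))
                                                           , proj₂ (R′⊆R q (proj₁ (T-∧⁻ r)))) vm
  ... | false = valid-prunePath x b m ds (λ q r → T-∧⁺ (proj₁ (R′⊆R q r)) (goesNo q (R′⊆R q r)) , proj₂ (R′⊆R q r)) vm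
    where
    goesNo : ∀ q → T (R q) × test x q ≡ b → T (not (test t q))
    goesNo q (_ , xb) with test t q in tq
    ... | false = _
    ... | true  = subst T ce (consistent⁺ t x q tq xb)

testOf : Maybe (Tree n) → Maybe (Test n)
testOf (just (node t _ _)) = just t
testOf _                   = nothing

testAt≡testOf : (t : Tree n) (p : Pos) → testAt t p ≡ testOf (subtree t p)
testAt≡testOf t p with subtree t p
... | just (node _ _ _) = refl
... | just (leaf _)     = refl
... | nothing           = refl

siblingIn : Tree n → List Bool → ℕ → Maybe (Outcome n)
siblingIn S ds s = Maybe.map (_, not (dirAt ds s)) (testOf (subtree S (take (s ∸ 1) ds)))

sibOutcome≡siblingIn : {Tr S : Tree n} (p₁ : Pos) (ds : List Bool) (s : ℕ) → subtree Tr p₁ ≡ just S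
                     → sibOutcome Tr p₁ ds s ≡ siblingIn S ds s
sibOutcome≡siblingIn {Tr = Tr} p₁ ds s h = begin
  sibOutcome Tr p₁ ds s
    ≡⟨ viaTestAt ⟩
  Maybe.map (_, d) (testAt Tr (p₁ ++ take (s ∸ 1) ds))
    ≡⟨ cong (Maybe.map (_, d)) (testAt≡testOf Tr (p₁ ++ take (s ∸ 1) ds)) ⟩
  Maybe.map (_, d) (testOf (subtree Tr (p₁ ++ take (s ∸ 1) ds)))
    ≡⟨ cong (Maybe.map (_, d) ∘ testOf) (subtree-++ p₁ _ h) ⟩
  siblingIn _ ds s ∎
  where
  open ≡-Reasoning
  d = not (dirAt ds s)
  viaTestAt : sibOutcome Tr p₁ ds s ≡ Maybe.map (_, d) (testAt Tr (pathNode p₁ ds s))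
  viaTestAt with testAt Tr (pathNode p₁ ds s)
  ... | just _  = refl
  ... | nothing = refl

IsXConsistentPrefix : Test n → Tree n → List Bool → Set
IsXConsistentPrefix x S ds = ∃[ rest ] IsXConsistentPath x S (ds ++ rest)

shiftExit : ℕ → ℕ
shiftExit zero    = zero
shiftExit (suc k) = suc (suc k)

-- q reaches u_k but not u_{k+1} for k = exitIndex S ds q, where u_1 is the root of S
-- and ds the path; k = 0 when q follows the whole path.
exitIndex : Tree n → List Bool → Fin n → ℕ
exitIndex (node t y m) (true ∷ ds)  q = if test t q then shiftExit (exitIndex y ds q) else 1
exitIndex (node t y m) (false ∷ ds) q = if test t q then 1 else shiftExit (exitIndex m ds q)
exitIndex _            _            _ = 0

shiftExit≢1 : (k : ℕ) → (shiftExit k ≡ᵇ 1) ≡ false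
shiftExit≢1 zero    = refl
shiftExit≢1 (suc k) = refl

shiftExit≡ᵇ-suc : (k i : ℕ) → (shiftExit k ≡ᵇ suc (suc i)) ≡ (k ≡ᵇ suc i)
shiftExit≡ᵇ-suc zero    i = refl
shiftExit≡ᵇ-suc (suc k) i = refl

shiftExit-beyond : (k i : ℕ) → ((shiftExit k ≡ᵇ 0) ∨ (suc i <ᵇ shiftExit k)) ≡ ((k ≡ᵇ 0) ∨ (i <ᵇ k))
shiftExit-beyond zero    i = refl
shiftExit-beyond (suc k) i = refl

nodesBeforeExit-shiftExit : (j k : ℕ) → nodesBeforeExit (suc j) (shiftExit k) ≡ suc (nodesBeforeExit j k)
nodesBeforeExit-shiftExit j zero    = refl
nodesBeforeExit-shiftExit j (suc k) = refl

reaches-sibling : (S : Tree n) (ds : List Bool) (q : Fin n) (i : ℕ) → i < length ds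
                → reaches S q (take i ds ++ not (dirAt ds (suc i)) ∷ []) ≡ (exitIndex S ds q ≡ᵇ suc i)
reaches-sibling (leaf _)     (_ ∷ _)      q zero    _ = refl
reaches-sibling (leaf _)     (_ ∷ _)      q (suc i) _ = refl
reaches-sibling (node t y m) (true ∷ ds)  q zero _ with test t q
... | true  = sym (shiftExit≢1 (exitIndex y ds q))
... | false = refl
reaches-sibling (node t y m) (false ∷ ds) q zero _ with test t q
... | true  = refl
... | false = sym (shiftExit≢1 (exitIndex m ds q))
reaches-sibling (node t y m) (true ∷ ds)  q (suc i) (s≤s i<j) with test t q
... | true  = trans (reaches-sibling y ds q i i<j) (sym (shiftExit≡ᵇ-suc (exitIndex y ds q) i))
... | false = refl
reaches-sibling (node t y m) (false ∷ ds) q (suc i) (s≤s i<j) with test t q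
... | true  = refl
... | false = trans (reaches-sibling m ds q i i<j) (sym (shiftExit≡ᵇ-suc (exitIndex m ds q) i))

reaches-pathNode : {x : Test n} (S : Tree n) (ds : List Bool) → IsXConsistentPrefix x S ds → (q : Fin n) (i : ℕ)
                 → i ≤ length ds → reaches S q (take i ds) ≡ ((exitIndex S ds q ≡ᵇ 0) ∨ (i <ᵇ exitIndex S ds q))
reaches-pathNode S ds _ q zero _ with exitIndex S ds q
... | zero  = refl
... | suc _ = refl
reaches-pathNode (node t y m) (true ∷ ds) (rest , _ , xp) q (suc i) (s≤s i≤j) with test t q
... | true  = trans (reaches-pathNode y ds (rest , xp) q i i≤j) (sym (shiftExit-beyond (exitIndex y ds q) i))
... | false = refl
reaches-pathNode (node t y m) (false ∷ ds) (rest , _ , xp) q (suc i) (s≤s i≤j) with test t q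
... | true  = refl
... | false = trans (reaches-pathNode m ds (rest , xp) q i i≤j) (sym (shiftExit-beyond (exitIndex m ds q) i))

exit-consistent : (x : Test n) (S : Tree n) (ds : List Bool) (q : Fin n) {k : ℕ} → exitIndex S ds q ≡ suc k
                → T (consistentM (siblingIn S ds (suc k)) (x , test x q)) × suc k ≤ length ds
exit-consistent x (node t y m) (true ∷ ds) q e with test t q in tq
exit-consistent x (node t y m) (true ∷ ds) q {zero} refl | false = consistent⁺ t x q tq refl , s≤s z≤n
... | true with exitIndex y ds q in ey
exit-consistent x (node t y m) (true ∷ ds) q {suc k} refl | true | suc k
  = map₂ s≤s (exit-consistent x y ds q ey)
exit-consistent x (node t y m) (false ∷ ds) q e with test t q in tq
exit-consistent x (node t y m) (false ∷ ds) q {zero} refl | true = consistent⁺ t x q tq refl , s≤s z≤n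
... | false with exitIndex m ds q in em
exit-consistent x (node t y m) (false ∷ ds) q {suc k} refl | false | suc k
  = map₂ s≤s (exit-consistent x m ds q em)

sibling-exclusive : {x : Test n} (S : Tree n) (ds : List Bool) → IsXConsistentPrefix x S ds
                  → {s : ℕ} → 1 ≤ s → s ≤ length ds
                  → ¬ (T (consistentM (siblingIn S ds s) (x , true)) × T (consistentM (siblingIn S ds s) (x , false)))
sibling-exclusive {x = x} (node t y m) (true ∷ ds) (_ , on , _) {suc zero} _ _ (sib-yes , sib-no) =
  consistentBoth-exclusive x t true on (T-∧⁺ sib-yes sib-no)
sibling-exclusive {x = x} (node t y m) (false ∷ ds) (_ , on , _) {suc zero} _ _ (sib-yes , sib-no) =
  consistentBoth-exclusive x t false on (T-∧⁺ sib-yes sib-no)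
sibling-exclusive (node t y m) (true ∷ ds) (rest , _ , xp) {suc (suc s)} _ (s≤s s<j) =
  sibling-exclusive y ds (rest , xp) (s≤s z≤n) s<j
sibling-exclusive (node t y m) (false ∷ ds) (rest , _ , xp) {suc (suc s)} _ (s≤s s<j) =
  sibling-exclusive m ds (rest , xp) (s≤s z≤n) s<j

contractedOnPath : Test n → Bool → Tree n → List Bool → Fin n → ℕ
contractedOnPath x b (node t y m) (true ∷ ds) q =
  if test t q then (if not (consistent (t , false) (x , b)) then 1 else 0) ℕ.+ contractedOnPath x b y ds q else 0
contractedOnPath x b (node t y m) (false ∷ ds) q =
  if test t q then 0 else (if not (consistent (t , true) (x , b)) then 1 else 0) ℕ.+ contractedOnPath x b m ds q
contractedOnPath _ _ _ _ _ = 0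

depth-prunePath : (x : Test n) (b : Bool) (S : Tree n) (ds : List Bool) (q : Fin n) → test x q ≡ b
                → depth (prunePath x b S ds) q ℕ.+ contractedOnPath x b S ds q ≡ depth S q
depth-prunePath x b (leaf _)     []      q _ = refl
depth-prunePath x b (node _ _ _) []      q _ = ℕ.+-identityʳ _
depth-prunePath x b (leaf _)     (_ ∷ _) q _ = refl
depth-prunePath x b (node t y m) (true ∷ ds) q xq with consistent (t , false) (x , b) in ce
... | true with test t q
...   | true  = cong suc (depth-prunePath x b y ds q xq)
...   | false = ℕ.+-identityʳ _
depth-prunePath x b (node t y m) (true ∷ ds) q xq | false with test t q in tq
...   | true  = trans (ℕ.+-suc _ _) (cong suc (depth-prunePath x b y ds q xq))
...   | false = ⊥-elim (subst T ce (consistent⁺ t x q tq xq))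
depth-prunePath x b (node t y m) (false ∷ ds) q xq with consistent (t , true) (x , b) in ce
... | true with test t q
...   | false = cong suc (depth-prunePath x b m ds q xq)
...   | true  = ℕ.+-identityʳ _
depth-prunePath x b (node t y m) (false ∷ ds) q xq | false with test t q in tq
...   | false = trans (ℕ.+-suc _ _) (cong suc (depth-prunePath x b m ds q xq))
...   | true  = ⊥-elim (subst T ce (consistent⁺ t x q tq xq))

inconsistentSiblings : Test n → Bool → Tree n → List Bool → ℕ → ℕ
inconsistentSiblings x b S ds K = count (λ s → not (consistentM (siblingIn S ds s) (x , b))) (range 1 K)

siblingIn-node : (t : Test n) (y m : Tree n) (d : Bool) (ds : List Bool) {s : ℕ} → 1 ≤ s
               → siblingIn (node t y m) (d ∷ ds) (suc s) ≡ siblingIn (child d y m) ds s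
siblingIn-node t y m true  ds {suc s} _ = refl
siblingIn-node t y m false ds {suc s} _ = refl

inconsistentSiblings-node : (x t : Test n) (b : Bool) (y m : Tree n) (d : Bool) (ds : List Bool) (K : ℕ)
                          → inconsistentSiblings x b (node t y m) (d ∷ ds) (suc K)
                            ≡ (if not (consistent (t , not d) (x , b)) then 1 else 0) ℕ.+ inconsistentSiblings x b (child d y m) ds K
inconsistentSiblings-node x t b y m d ds K =
  trans (count-range1-suc _ K)
        (cong (_ ℕ.+_) (count-cong (range 1 K) λ s∈ →
          cong (λ o → not (consistentM o (x , b))) (siblingIn-node t y m d ds (proj₁ (∈-range⁻ 1 K s∈)))))

contractedOnPath≡inconsistentSiblings : (x : Test n) (b : Bool) (S : Tree n) (ds : List Bool) → IsXConsistentPrefix x S ds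
  → (q : Fin n) → contractedOnPath x b S ds q ≡ inconsistentSiblings x b S ds (nodesBeforeExit (length ds) (exitIndex S ds q))
contractedOnPath≡inconsistentSiblings x b (leaf _)     []          _ q = refl
contractedOnPath≡inconsistentSiblings x b (node _ _ _) []          _ q = refl
contractedOnPath≡inconsistentSiblings x b (node t y m) (true ∷ ds) (rest , _ , xp) q with test t q
... | false = refl
... | true  = begin
  (if not (consistent (t , false) (x , b)) then 1 else 0) ℕ.+ contractedOnPath x b y ds q
    ≡⟨ cong (_ ℕ.+_) (contractedOnPath≡inconsistentSiblings x b y ds (rest , xp) q) ⟩
  (if not (consistent (t , false) (x , b)) then 1 else 0) ℕ.+ inconsistentSiblings x b y ds (nodesBeforeExit (length ds) e)
    ≡⟨ inconsistentSiblings-node x t b y m true ds (nodesBeforeExit (length ds) e) ⟨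
  inconsistentSiblings x b (node t y m) (true ∷ ds) (suc (nodesBeforeExit (length ds) e))
    ≡⟨ cong (inconsistentSiblings x b (node t y m) (true ∷ ds)) (nodesBeforeExit-shiftExit (length ds) e) ⟨
  inconsistentSiblings x b (node t y m) (true ∷ ds) (nodesBeforeExit (suc (length ds)) (shiftExit e)) ∎
  where
  open ≡-Reasoning
  e = exitIndex y ds q
contractedOnPath≡inconsistentSiblings x b (node t y m) (false ∷ ds) (rest , _ , xp) q with test t q
... | true  = refl
... | false = begin
  (if not (consistent (t , true) (x , b)) then 1 else 0) ℕ.+ contractedOnPath x b m ds q
    ≡⟨ cong (_ ℕ.+_) (contractedOnPath≡inconsistentSiblings x b m ds (rest , xp) q) ⟩
  (if not (consistent (t , true) (x , b)) then 1 else 0) ℕ.+ inconsistentSiblings x b m ds (nodesBeforeExit (length ds) e)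
    ≡⟨ inconsistentSiblings-node x t b y m false ds (nodesBeforeExit (length ds) e) ⟨
  inconsistentSiblings x b (node t y m) (false ∷ ds) (suc (nodesBeforeExit (length ds) e))
    ≡⟨ cong (inconsistentSiblings x b (node t y m) (false ∷ ds)) (nodesBeforeExit-shiftExit (length ds) e) ⟨
  inconsistentSiblings x b (node t y m) (false ∷ ds) (nodesBeforeExit (suc (length ds)) (shiftExit e)) ∎
  where
  open ≡-Reasoning
  e = exitIndex m ds q

ℤtoℚᵘ : (a : ℤ) → ℚ.toℚᵘ (ℤtoℚ a) ℚᵘ.≃ ℚᵘ.mkℚᵘ a 0
ℤtoℚᵘ a = ℚ.toℚᵘ-fromℚᵘ (ℚᵘ.mkℚᵘ a 0)

ℤtoℚ-homo-+ : (a b : ℤ) → ℤtoℚ (a ℤ.+ b) ≡ ℤtoℚ a ℚ.+ ℤtoℚ b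
ℤtoℚ-homo-+ a b = ℚ.toℚᵘ-injective (begin
  ℚ.toℚᵘ (ℤtoℚ (a ℤ.+ b))                   ≈⟨ ℤtoℚᵘ (a ℤ.+ b) ⟩
  ℚᵘ.mkℚᵘ (a ℤ.+ b) 0                        ≈⟨ ℚᵘ.*≡* (distrib a b) ⟩
  ℚᵘ.mkℚᵘ a 0 ℚᵘ.+ ℚᵘ.mkℚᵘ b 0               ≈⟨ ℚᵘ.+-cong (ℚᵘ.≃-sym (ℤtoℚᵘ a)) (ℚᵘ.≃-sym (ℤtoℚᵘ b)) ⟩
  ℚ.toℚᵘ (ℤtoℚ a) ℚᵘ.+ ℚ.toℚᵘ (ℤtoℚ b)      ≈⟨ ℚᵘ.≃-sym (ℚ.toℚᵘ-homo-+ (ℤtoℚ a) (ℤtoℚ b)) ⟩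
  ℚ.toℚᵘ (ℤtoℚ a ℚ.+ ℤtoℚ b)                ∎)
  where
  open ℚᵘ.≃-Reasoning
  distrib : ∀ a b → (a ℤ.+ b) ℤ.* + 1 ≡ (a ℤ.* + 1 ℤ.+ b ℤ.* + 1) ℤ.* + 1
  distrib = solve-∀

ℤtoℚ-homo-* : (a b : ℤ) → ℤtoℚ (a ℤ.* b) ≡ ℤtoℚ a ℚ.* ℤtoℚ b
ℤtoℚ-homo-* a b = ℚ.toℚᵘ-injective (begin
  ℚ.toℚᵘ (ℤtoℚ (a ℤ.* b))                   ≈⟨ ℤtoℚᵘ (a ℤ.* b) ⟩
  ℚᵘ.mkℚᵘ a 0 ℚᵘ.* ℚᵘ.mkℚᵘ b 0               ≈⟨ ℚᵘ.*-cong (ℚᵘ.≃-sym (ℤtoℚᵘ a)) (ℚᵘ.≃-sym (ℤtoℚᵘ b)) ⟩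
  ℚ.toℚᵘ (ℤtoℚ a) ℚᵘ.* ℚ.toℚᵘ (ℤtoℚ b)      ≈⟨ ℚᵘ.≃-sym (ℚ.toℚᵘ-homo-* (ℤtoℚ a) (ℤtoℚ b)) ⟩
  ℚ.toℚᵘ (ℤtoℚ a ℚ.* ℤtoℚ b)                ∎)
  where open ℚᵘ.≃-Reasoning

ℤtoℚ-mono-≤ : {a b : ℤ} → a ℤ.≤ b → ℤtoℚ a ℚ.≤ ℤtoℚ b
ℤtoℚ-mono-≤ {a} {b} a≤b = ℚ.toℚᵘ-cancel-≤
  (ℚᵘ.≤-respˡ-≃ (ℚᵘ.≃-sym (ℤtoℚᵘ a)) (ℚᵘ.≤-respʳ-≃ (ℚᵘ.≃-sym (ℤtoℚᵘ b))
    (ℚᵘ.*≤* (subst₂ ℤ._≤_ (sym (ℤ.*-identityʳ a)) (sym (ℤ.*-identityʳ b)) a≤b))))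

sumL : {A : Set} → (A → ℚ) → List A → ℚ
sumL f = foldr (λ a acc → f a ℚ.+ acc) 0ℚ

module _ {A : Set} where

  sumL-cong : {f g : A → ℚ} (xs : List A) → (∀ a → f a ≡ g a) → sumL f xs ≡ sumL g xs
  sumL-cong []       _ = refl
  sumL-cong (a ∷ xs) h = cong₂ ℚ._+_ (h a) (sumL-cong xs h)

  sumL-mono-≤ : {f g : A → ℚ} (xs : List A) → (∀ a → f a ℚ.≤ g a) → sumL f xs ℚ.≤ sumL g xs
  sumL-mono-≤ []       _ = ℚ.≤-refl
  sumL-mono-≤ (a ∷ xs) h = ℚ.+-mono-≤ (h a) (sumL-mono-≤ xs h)

  sumL-zero : (xs : List A) → sumL (λ _ → 0ℚ) xs ≡ 0ℚ
  sumL-zero []       = refl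
  sumL-zero (_ ∷ xs) = trans (ℚ.+-identityˡ _) (sumL-zero xs)

  sumL-+ : (f g : A → ℚ) (xs : List A) → sumL (λ a → f a ℚ.+ g a) xs ≡ sumL f xs ℚ.+ sumL g xs
  sumL-+ f g []       = refl
  sumL-+ f g (a ∷ xs) = trans (cong (f a ℚ.+ g a ℚ.+_) (sumL-+ f g xs)) (interchange (f a) (g a) _ _)
    where
    open ℚ-Solver.+-*-Solver
    interchange : ∀ a b c d → (a ℚ.+ b) ℚ.+ (c ℚ.+ d) ≡ (a ℚ.+ c) ℚ.+ (b ℚ.+ d)
    interchange = solve 4 (λ a b c d → (a :+ b) :+ (c :+ d) := (a :+ c) :+ (b :+ d)) refl

  sumL-*ˡ : (r : ℚ) (f : A → ℚ) (xs : List A) → r ℚ.* sumL f xs ≡ sumL (λ a → r ℚ.* f a) xs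
  sumL-*ˡ r f []       = ℚ.*-zeroʳ r
  sumL-*ˡ r f (a ∷ xs) = trans (ℚ.*-distribˡ-+ r (f a) _) (cong (r ℚ.* f a ℚ.+_) (sumL-*ˡ r f xs))

sumL-comm : {A B : Set} (f : A → B → ℚ) (xs : List A) (ys : List B)
          → sumL (λ a → sumL (f a) ys) xs ≡ sumL (λ b → sumL (λ a → f a b) xs) ys
sumL-comm f []       ys = sym (sumL-zero ys)
sumL-comm f (a ∷ xs) ys = trans (cong (sumL (f a) ys ℚ.+_) (sumL-comm f xs ys)) (sym (sumL-+ (f a) _ ys))

sumL-ℤtoℚ : (g : ℕ → ℤ) (xs : List ℕ) → sumL (ℤtoℚ ∘ g) xs ≡ ℤtoℚ (sumℤ g xs)
sumL-ℤtoℚ g []       = refl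
sumL-ℤtoℚ g (i ∷ xs) = trans (cong (ℤtoℚ (g i) ℚ.+_) (sumL-ℤtoℚ g xs)) (sym (ℤtoℚ-homo-+ (g i) _))

+-cancelʳ-≤ : (a b c : ℚ) → a ℚ.+ c ℚ.≤ b ℚ.+ c → a ℚ.≤ b
+-cancelʳ-≤ a b c h = subst₂ ℚ._≤_ (cancel a c) (cancel b c) (ℚ.+-monoˡ-≤ (ℚ.- c) h)
  where
  open ℚ-Solver.+-*-Solver
  cancel : ∀ u v → (u ℚ.+ v) ℚ.+ ℚ.- v ≡ u
  cancel = solve 2 (λ u v → (u :+ v) :+ (:- v) := u) refl

-- The exchange argument

exchange-≤ : (a i : ℤ) (d′ d r : ℕ) → d′ ℕ.+ r ≡ suc d → a ℤ.+ + 1 ℤ.≤ i ℤ.+ + r → a ℤ.+ + d′ ℤ.≤ i ℤ.+ + d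
exchange-≤ a i d′ d r d′+r≡1+d a<i+r = begin
  a ℤ.+ + d′                     ≡⟨ cong (ℤ._+_ a) d′≡ ⟩
  a ℤ.+ ((+ 1 ℤ.+ + d) - + r)    ≡⟨ regroup a (+ d) (+ r) ⟩
  (a ℤ.+ + 1) ℤ.+ (+ d - + r)    ≤⟨ ℤ.+-monoˡ-≤ (+ d - + r) a<i+r ⟩
  (i ℤ.+ + r) ℤ.+ (+ d - + r)    ≡⟨ cancel i (+ d) (+ r) ⟩
  i ℤ.+ + d                      ∎
  where
  open ℤ.≤-Reasoning
  d′≡ : + d′ ≡ (+ 1 ℤ.+ + d) - + r
  d′≡ = trans (addSub (+ d′) (+ r)) (cong (_- + r) (trans (sym (ℤ.pos-+ d′ r)) (cong +_ d′+r≡1+d)))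
    where
    addSub : ∀ u v → u ≡ (u ℤ.+ v) - v
    addSub = solve-∀
  regroup : ∀ a d r → a ℤ.+ ((+ 1 ℤ.+ d) - r) ≡ (a ℤ.+ + 1) ℤ.+ (d - r)
  regroup = solve-∀
  cancel : ∀ i d r → (i ℤ.+ r) ℤ.+ (d - r) ≡ i ℤ.+ d
  cancel = solve-∀

module Exchange {n : ℕ} (w : Fin n → ℚ) (w≥0 : ∀ q → w q ℚ.≥ 0ℚ) {K : Subset n} {C : List (Subset n)}
  (Tr : Tree n) (Tr-valid : IsDecisionTree K C Tr) (x : Test n) (x-allowed : Allowed K x)
  (p₁ : Pos) {S : Tree n} (S-at-p₁ : subtree Tr p₁ ≡ just S)
  (ds : List Bool) (1≤j : 1 ≤ length ds) (path : IsXConsistentPrefix x S ds) where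

  j : ℕ
  j = length ds

  exchanged : Tree n
  exchanged = replace Tr p₁ (node x (prunePath x true S ds) (prunePath x false S ds))

  exchanged-valid : IsDecisionTree K C exchanged
  exchanged-valid = valid-replace Tr _ p₁ Tr-valid
    ( x-allowed
    , valid-prunePath x true  S ds (λ q r → proj₁ (T-∧⁻ r) , Equivalence.to T-≡ (proj₂ (T-∧⁻ r))) S-valid
    , valid-prunePath x false S ds (λ q r → proj₁ (T-∧⁻ r) , Equivalence.to T-not-≡ (proj₂ (T-∧⁻ r))) S-valid)
    where
    S-valid = valid-subtree Tr p₁ S-at-p₁ Tr-valid

  reaches-below : (q : Fin n) → reaches Tr q p₁ ≡ true → (p : Pos) → reaches Tr q (p₁ ++ p) ≡ reaches S q p
  reaches-below q reached p = trans (reaches-++ q p₁ p S-at-p₁) (cong (_∧ reaches S q p) reached)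

  unreached-below : (q : Fin n) → reaches Tr q p₁ ≡ false → (p : Pos) → reaches Tr q (p₁ ++ p) ≡ false
  unreached-below q unreached p = trans (reaches-++ q p₁ p S-at-p₁) (cong (_∧ reaches S q p) unreached)

  depth-exchanged : (q : Fin n) → reaches Tr q p₁ ≡ true
                  → depth exchanged q ℕ.+ contractedOnPath x (test x q) S ds q ≡ suc (depth Tr q)
  depth-exchanged q reached = ℕ.+-cancelʳ-≡ (depth pruned q) _ _ (begin
    depth exchanged q ℕ.+ contractedOnPath x b S ds q ℕ.+ depth pruned q
      ≡⟨ ℕ.+-assoc (depth exchanged q) _ _ ⟩
    depth exchanged q ℕ.+ (contractedOnPath x b S ds q ℕ.+ depth pruned q)
      ≡⟨ cong (depth exchanged q ℕ.+_) (trans (ℕ.+-comm _ (depth pruned q)) (depth-prunePath x b S ds q refl)) ⟩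
    depth exchanged q ℕ.+ depth S q
      ≡⟨ depth-replace _ q p₁ S-at-p₁ reached ⟩
    depth Tr q ℕ.+ depth (node x (prunePath x true S ds) (prunePath x false S ds)) q
      ≡⟨ cong (depth Tr q ℕ.+_) (depth-node x _ _ q) ⟩
    depth Tr q ℕ.+ suc (depth (child b (prunePath x true S ds) (prunePath x false S ds)) q)
      ≡⟨ cong (λ t → depth Tr q ℕ.+ suc (depth t q)) (split-by-x b) ⟩
    depth Tr q ℕ.+ suc (depth pruned q)
      ≡⟨ ℕ.+-suc _ _ ⟩
    suc (depth Tr q) ℕ.+ depth pruned q ∎)
    where
    open ≡-Reasoning
    b = test x q
    pruned = prunePath x b S ds
    split-by-x : ∀ v → child v (prunePath x true S ds) (prunePath x false S ds) ≡ prunePath x v S ds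
    split-by-x true  = refl
    split-by-x false = refl

  siblingConsistent : Bool → ℕ → Bool
  siblingConsistent b s = consistentM (sibOutcome Tr p₁ ds s) (x , b)

  open PathCounting siblingConsistent j

  siblingConsistent≡ : (b : Bool) (s : ℕ) → siblingConsistent b s ≡ consistentM (siblingIn S ds s) (x , b)
  siblingConsistent≡ b s = cong (λ o → consistentM o (x , b)) (sibOutcome≡siblingIn p₁ ds s S-at-p₁)

  exclusive : Exclusive
  exclusive {s} s∈ (yes , no) with 1≤s , s≤j ← ∈-range⁻ 1 j s∈ =
    sibling-exclusive S ds path 1≤s s≤j (subst T (siblingConsistent≡ true s) yes , subst T (siblingConsistent≡ false s) no)

  exitIndex-bounded : (q : Fin n) → exitIndex S ds q ≤ j
                    × (0 < exitIndex S ds q → T (siblingConsistent (test x q) (exitIndex S ds q)))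
  exitIndex-bounded q with exitIndex S ds q in e
  ... | zero  = z≤n , λ ()
  ... | suc k with consistent , k<j ← exit-consistent x S ds q e =
    k<j , λ _ → subst T (sym (siblingConsistent≡ (test x q) (suc k))) consistent

  contracted≡contractedOnPath : (q : Fin n)
    → contracted (test x q) (nodesBeforeExit j (exitIndex S ds q)) ≡ contractedOnPath x (test x q) S ds q
  contracted≡contractedOnPath q =
    trans (count-cong (range 1 (nodesBeforeExit j (exitIndex S ds q))) λ {s} _ → cong not (siblingConsistent≡ (test x q) s))
          (sym (contractedOnPath≡inconsistentSiblings x (test x q) S ds path q))

  contribution : Fin n → ℤ
  contribution q = endCoefficient ℤ.* 𝟙 (reaches Tr q (pathNode p₁ ds j))
                   ℤ.+ sumℤ (λ i → siblingCoefficient i ℤ.* 𝟙 (reaches Tr q (pathSibling p₁ ds i))) (range 3 j)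

  contribution≡exitContribution : (q : Fin n) → reaches Tr q p₁ ≡ true
                                → contribution q ≡ exitContribution (exitIndex S ds q)
  contribution≡exitContribution q reached =
    cong₂ (λ u v → endCoefficient ℤ.* 𝟙 u ℤ.+ v)
          (trans (reaches-below q reached _) (reaches-pathNode S ds path q (j ∸ 1) (ℕ.m∸n≤m j 1)))
          (sumℤ-cong (range 3 j) sibling)
    where
    sibling : ∀ {i} → i ∈ range 3 j → siblingCoefficient i ℤ.* 𝟙 (reaches Tr q (pathSibling p₁ ds i))
                                    ≡ siblingCoefficient i ℤ.* 𝟙 (exitIndex S ds q ≡ᵇ i ∸ 1)
    sibling {zero}        i∈ with () ← proj₁ (∈-range⁻ 3 j i∈)
    sibling {suc zero}    i∈ with s≤s () ← proj₁ (∈-range⁻ 3 j i∈)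
    sibling {suc (suc i)} i∈ = cong (λ v → siblingCoefficient (suc (suc i)) ℤ.* 𝟙 v)
      (trans (reaches-below q reached _) (reaches-sibling S ds q i (ℕ.<⇒≤ (proj₂ (∈-range⁻ 3 j i∈)))))

  contribution-unreached : (q : Fin n) → reaches Tr q p₁ ≡ false → contribution q ≡ + 0
  contribution-unreached q unreached = begin
    contribution q
      ≡⟨ cong₂ (λ u v → endCoefficient ℤ.* 𝟙 u ℤ.+ v) (unreached-below q unreached _)
               (sumℤ-zero (range 3 j) λ {i} _ → trans (cong (λ v → siblingCoefficient i ℤ.* 𝟙 v) (unreached-below q unreached _))
                                                      (ℤ.*-zeroʳ (siblingCoefficient i))) ⟩
    endCoefficient ℤ.* + 0 ℤ.+ + 0
      ≡⟨ cong (ℤ._+ + 0) (ℤ.*-zeroʳ endCoefficient) ⟩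
    + 0 ∎
    where open ≡-Reasoning

  contribution-bound : (q : Fin n)
    → contribution q ℤ.+ + depth exchanged q ℤ.≤ 𝟙 (reaches Tr q (pathSibling p₁ ds 2)) ℤ.+ + depth Tr q
  contribution-bound q with reaches Tr q p₁ in reached
  ... | false = ℤ.≤-reflexive (cong₂ ℤ._+_
          (trans (contribution-unreached q reached) (cong 𝟙 (sym (unreached-below q reached _))))
          (cong +_ (depth-replace-unreached Tr _ q p₁ reached)))
  ... | true = exchange-≤ (contribution q) (𝟙 (reaches Tr q (pathSibling p₁ ds 2))) (depth exchanged q) (depth Tr q) _
                           (depth-exchanged q reached) saving
    where
    reaches-u₂′ : reaches Tr q (pathSibling p₁ ds 2) ≡ (exitIndex S ds q ≡ᵇ 1)
    reaches-u₂′ = trans (reaches-below q reached _) (reaches-sibling S ds q 0 1≤j)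
    saving : contribution q ℤ.+ + 1 ℤ.≤ 𝟙 (reaches Tr q (pathSibling p₁ ds 2)) ℤ.+ + contractedOnPath x (test x q) S ds q
    saving = subst₂ ℤ._≤_ (cong (ℤ._+ + 1) (sym (contribution≡exitContribution q reached)))
                          (cong₂ (λ u v → 𝟙 u ℤ.+ + v) (sym reaches-u₂′) (contracted≡contractedOnPath q))
                          (exitContribution<contracted exclusive (test x q) (proj₁ (exitIndex-bounded q)) (proj₂ (exitIndex-bounded q)))

  weighted : (Fin n → ℤ) → ℚ
  weighted f = sumL (λ q → w q ℚ.* ℤtoℚ (f q)) (allFin n)

  weighted-+ : (f g : Fin n → ℤ) → weighted (λ q → f q ℤ.+ g q) ≡ weighted f ℚ.+ weighted g
  weighted-+ f g =
    trans (sumL-cong (allFin n) λ q → trans (cong (w q ℚ.*_) (ℤtoℚ-homo-+ (f q) (g q)))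
                                            (ℚ.*-distribˡ-+ (w q) (ℤtoℚ (f q)) (ℤtoℚ (g q))))
          (sumL-+ (λ q → w q ℚ.* ℤtoℚ (f q)) (λ q → w q ℚ.* ℤtoℚ (g q)) (allFin n))

  weighted-mono-≤ : {f g : Fin n → ℤ} → (∀ q → f q ℤ.≤ g q) → weighted f ℚ.≤ weighted g
  weighted-mono-≤ f≤g = sumL-mono-≤ (allFin n) λ q →
    ℚ.*-monoˡ-≤-nonNeg (w q) ⦃ ℚ.nonNegative (w≥0 q) ⦄ (ℤtoℚ-mono-≤ (f≤g q))

  weightAt≡weighted : (p : Pos) → weightAt w Tr p ≡ weighted (λ q → 𝟙 (reaches Tr q p))
  weightAt≡weighted p = sumL-cong (allFin n) λ q → indicator q (reaches Tr q p)
    where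
    indicator : ∀ q v → (if v then w q else 0ℚ) ≡ w q ℚ.* ℤtoℚ (𝟙 v)
    indicator q true  = sym (ℚ.*-identityʳ (w q))
    indicator q false = sym (ℚ.*-zeroʳ (w q))

  scaled-weightAt : (a : ℤ) (p : Pos) → ℤtoℚ a ℚ.* weightAt w Tr p ≡ weighted (λ q → a ℤ.* 𝟙 (reaches Tr q p))
  scaled-weightAt a p = trans (cong (ℤtoℚ a ℚ.*_) (weightAt≡weighted p))
    (trans (sumL-*ˡ (ℤtoℚ a) _ (allFin n)) (sumL-cong (allFin n) λ q →
      trans (swap-scalar (ℤtoℚ a) (w q) _) (cong (w q ℚ.*_) (sym (ℤtoℚ-homo-* a _)))))
    where
    open ℚ-Solver.+-*-Solver
    swap-scalar : ∀ a u v → a ℚ.* (u ℚ.* v) ≡ u ℚ.* (a ℚ.* v)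
    swap-scalar = solve 3 (λ a u v → a :* (u :* v) := u :* (a :* v)) refl

  bound≡weighted : ℤtoℚ endCoefficient ℚ.* weightAt w Tr (pathNode p₁ ds j)
                   ℚ.+ sumRangeQ (λ i → ℤtoℚ (siblingCoefficient i) ℚ.* weightAt w Tr (pathSibling p₁ ds i)) (range 3 j)
                   ≡ weighted contribution
  bound≡weighted = trans (cong₂ ℚ._+_ (scaled-weightAt endCoefficient (pathNode p₁ ds j)) siblings)
                         (sym (weighted-+ (λ q → endCoefficient ℤ.* 𝟙 (reaches Tr q (pathNode p₁ ds j)))
                                          (λ q → sumℤ (λ i → siblingTerm i q) (range 3 j))))
    where
    open ≡-Reasoning
    siblingTerm : ℕ → Fin n → ℤ
    siblingTerm i q = siblingCoefficient i ℤ.* 𝟙 (reaches Tr q (pathSibling p₁ ds i))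
    siblings : sumRangeQ (λ i → ℤtoℚ (siblingCoefficient i) ℚ.* weightAt w Tr (pathSibling p₁ ds i)) (range 3 j)
             ≡ weighted (λ q → sumℤ (λ i → siblingTerm i q) (range 3 j))
    siblings = begin
      sumL (λ i → ℤtoℚ (siblingCoefficient i) ℚ.* weightAt w Tr (pathSibling p₁ ds i)) (range 3 j)
        ≡⟨ sumL-cong (range 3 j) (λ i → scaled-weightAt (siblingCoefficient i) (pathSibling p₁ ds i)) ⟩
      sumL (λ i → weighted (siblingTerm i)) (range 3 j)
        ≡⟨ sumL-comm (λ i q → w q ℚ.* ℤtoℚ (siblingTerm i q)) (range 3 j) (allFin n) ⟩
      sumL (λ q → sumL (λ i → w q ℚ.* ℤtoℚ (siblingTerm i q)) (range 3 j)) (allFin n)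
        ≡⟨ sumL-cong (allFin n) (λ q → trans (sym (sumL-*ˡ (w q) _ (range 3 j)))
                                            (cong (w q ℚ.*_) (sumL-ℤtoℚ (λ i → siblingTerm i q) (range 3 j)))) ⟩
      weighted (λ q → sumℤ (λ i → siblingTerm i q) (range 3 j)) ∎

  contribution≤weight : MinCost w K C Tr → weighted contribution ℚ.≤ weightAt w Tr (pathSibling p₁ ds 2)
  contribution≤weight minimal = +-cancelʳ-≤ _ _ (cost w exchanged) (begin
    weighted contribution ℚ.+ cost w exchanged               ≡⟨ weighted-+ contribution (λ q → + depth exchanged q) ⟨
    weighted (λ q → contribution q ℤ.+ + depth exchanged q)  ≤⟨ weighted-mono-≤ contribution-bound ⟩
    weighted (λ q → 𝟙 (reaches Tr q u₂′) ℤ.+ + depth Tr q)   ≡⟨ weighted-+ (λ q → 𝟙 (reaches Tr q u₂′)) (λ q → + depth Tr q) ⟩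
    weighted (λ q → 𝟙 (reaches Tr q u₂′)) ℚ.+ cost w Tr      ≡⟨ cong (ℚ._+ cost w Tr) (weightAt≡weighted u₂′) ⟨
    weightAt w Tr u₂′ ℚ.+ cost w Tr                          ≤⟨ ℚ.+-monoʳ-≤ (weightAt w Tr u₂′) (minimal exchanged exchanged-valid) ⟩
    weightAt w Tr u₂′ ℚ.+ cost w exchanged                   ∎)
    where
    open ℚ.≤-Reasoning
    u₂′ = pathSibling p₁ ds 2

lemma4 : {n : ℕ} (w : Fin n → ℚ) → ((q : Fin n) → w q ≥ 0ℚ)
  → (C : List (Subset n)) → CoversQ C → (K : Subset n)
  → (Tr : Tree n) → IsDecisionTree K C Tr → Irreducible C Tr → MinCost w K C Tr
  → (x : Test n) → Allowed K x
  → (p₁ : Pos) (S : Tree n) → subtree Tr p₁ ≡ just S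
  → (ds : List Bool) → 1 ≤ length ds
  → (∃[ rest ] IsXConsistentPath x S (ds ++ rest))
  → weightAt w Tr (pathSibling p₁ ds 2)
    ≥ (ℤtoℚ ((+ length ds - + 1 - + β′ Tr x p₁ ds) ⊓ (+ β′ Tr x p₁ ds - + 1))
         * weightAt w Tr (pathNode p₁ ds (length ds)))
      + sumRangeQ (λ i → ℤtoℚ (+ δ Tr x p₁ ds (i Data.Nat.∸ 1) - + 1) * weightAt w Tr (pathSibling p₁ ds i))
                  (range 3 (length ds))
lemma4 w w≥0 C _ K Tr Tr-valid _ minimal x x-allowed p₁ S S-at-p₁ ds 1≤j path =
  subst (ℚ._≤ weightAt w Tr (pathSibling p₁ ds 2)) (sym bound≡weighted) (contribution≤weight minimal)
  where open Exchange w w≥0 Tr Tr-valid x x-allowed p₁ S-at-p₁ ds 1≤j path
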